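{- For $n,k\ge0$ let $p_{n,k}$ be the number of integers $m\in[0,a_{2n+1})$ whose Kentucky-2 legal decomposition has exactly $k$ summands, and let $g_n(y)=\sum_{k\ge0}p_{n,k}y^k$ be the coefficient of $x^n$ in $F(x,y)=\sum_{n,k\ge0}p_{n,k}x^ny^k$. Then for $y>0$, \[ g_n(y)=\frac{1}{2^{n+1}\sqrt{1+8y}}\Big[4y\big(1+\sqrt{1+8y}\big)^n-4y\big(1-\sqrt{1+8y}\big)^n+\big(1+\sqrt{1+8y}\big)^{n+1}-\big(1-\sqrt{1+8y}\big)^{n+1}\Big]. \]
   Context: The Kentucky-2 sequence $(a_n)_{n\ge1}$: index $\ell$ belongs to bin $\lceil \ell/2\rceil$. A legal decomposition of $m\ge0$ using $\{a_1,\dots,a_N\}$ is $m=a_{\ell_1}+\cdots+a_{\ell_k}$, $k\ge0$, $1\le\ell_1<\cdots<\ell_k\le N$, with $\lceil \ell_{j+1}/2\rceil-\lceil \ell_j/2\rceil\ge2$ for all $j$. The sequence is defined by $a_1=1$ and, for $N\ge1$, $a_{N+1}$ is the smallest positive integer with no legal decomposition using $\{a_1,\dots,a_N\}$ (first terms $1,2,3,4,5,8,11,16,\dots$). Every nonnegative integer has a unique legal decomposition (that of $0$ is empty). -}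

module Defs where

open import Data.Nat using (ℕ; zero; suc; _≤ᵇ_; _≡ᵇ_; ⌈_/2⌉)

open import Data.Nat using (_+_; _*_)
open import Data.Nat.ListAction using (sum)
open import Data.Bool.ListAction using (any)
open import Data.Bool using (Bool; true; false; _∧_; if_then_else_)
open import Data.List using (List; []; _∷_; _++_; [_]; map; length; filterᵇ; upTo)
open import Algebra.Bundles using (CommutativeRing)

bin : ℕ → ℕ
bin ℓ = ⌈ ℓ /2⌉

-- all sublists (order preserved) of a list; sublists of [1..N] are exactly
-- the strictly increasing index lists with entries in [1, N]
sublists : List ℕ → List (List ℕ)
sublists [] = [] ∷ []
sublists (x ∷ xs) = map (x ∷_) (sublists xs) ++ sublists xs

indices : ℕ → List ℕ
indices N = map suc (upTo N)

legal : List ℕ → Bool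
legal [] = true
legal (ℓ ∷ []) = true
legal (ℓ ∷ ℓ' ∷ rest) = (2 + bin ℓ ≤ᵇ bin ℓ') ∧ legal (ℓ' ∷ rest)

-- 1-based lookup in the list of terms [a_1, ..., a_N] (0 outside range)
val : List ℕ → ℕ → ℕ
val [] _ = 0
val (t ∷ ts) zero = 0
val (t ∷ ts) (suc zero) = t
val (t ∷ ts) (suc (suc i)) = val ts (suc i)

legalSets : List ℕ → List (List ℕ)
legalSets ts = filterᵇ legal (sublists (indices (length ts)))

value : List ℕ → List ℕ → ℕ
value ts S = sum (map (val ts) S)

hasDecomp : List ℕ → ℕ → Bool
hasDecomp ts m = any (λ S → value ts S ≡ᵇ m) (legalSets ts)

findFrom : List ℕ → ℕ → ℕ → ℕ
findFrom ts zero m = m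
findFrom ts (suc f) m = if hasDecomp ts m then findFrom ts f (suc m) else m

-- Candidates 1 .. sum ts are checked; sum ts + 1 is never decomposable
-- (every decomposition is at most sum ts), so the fallback is exact.
next : List ℕ → ℕ
next ts = findFrom ts (sum ts) 1

terms : ℕ → List ℕ
terms zero = []
terms (suc N) = terms N ++ [ next (terms N) ]

-- a ℓ = a_ℓ for ℓ ≥ 1 (a 0 = 0 is junk)
a : ℕ → ℕ
a ℓ = val (terms ℓ) ℓ

hasDecompWith : ℕ → ℕ → ℕ → Bool
hasDecompWith N k m =
  any (λ S → (value (terms N) S ≡ᵇ m) ∧ (length S ≡ᵇ k)) (legalSets (terms N))

p : ℕ → ℕ → ℕ
p n k = length (filterᵇ (hasDecompWith (suc (2 * n)) k) (upTo (a (suc (2 * n)))))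

module RingOps {c ℓ} (R : CommutativeRing c ℓ) where
  open CommutativeRing R hiding (_+_; _*_)
  open CommutativeRing R using () renaming (_+_ to _+R_; _*_ to _*R_)

  ι : ℕ → Carrier
  ι zero = 0#
  ι (suc n) = 1# +R ι n

  infixr 8 _^′_
  _^′_ : Carrier → ℕ → Carrier
  x ^′ zero = 1#
  x ^′ suc n = x *R (x ^′ n)

  sumTo : ℕ → (ℕ → Carrier) → Carrier
  sumTo zero f = f 0
  sumTo (suc K) f = sumTo K f +R f (suc K)

  -- g_n(y) = Σ_k p_{n,k} y^k ; p_{n,k} = 0 for k > 2n+1 (a legal index set
  -- drawn from [1, 2n+1] has at most 2n+1 elements), so the sum is complete.
  g : ℕ → Carrier → Carrier
  g n y = sumTo (suc (2 * n)) (λ k → ι (p n k) *R y ^′ k)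

-- The sequence `terms` of Defs is identified
-- with seqK, defined by a_{N+4} = a_{N+2} + 2 a_N, which satisfies
-- a_{N+2} = a_{N+1} + a_{maxPrev(N+1)+1}; maxPrev ℓ = 2(⌈ℓ/2⌉ − 2) is the largest
-- index that may precede ℓ.  Legal index lists are described inductively (Legal),
-- by whether they use their top index: a legal sum of a_1 … a_N is below a_{N+1}
-- and the greedy algorithm reaches every smaller number.  Splitting [0, a_{N+2})
-- at a_{N+1} and removing the largest summand gives count-rec; two steps of it
-- give p_{j+1,k} = p_{j,k} + 2 p_{j−1,k−1}.
--
-- Hence P_j = Σ_k p_{j,k} y^k obeys
-- P_{j+2} = P_{j+1} + 2y P_j, so 2^{n+1} s P_n solves u_{n+2} = 2u_{n+1} + 8y u_n,
-- as do (1 ± s)^n, the powers of the roots of x² = 2x + 8y.  Such solutions are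
-- determined by two initial values, and checking n = 0, 1 yields the formula.
module Submission where

open import Defs
open import Data.Nat using (ℕ; suc)
open import Algebra.Bundles using (CommutativeRing)

module Counting where

  open import Data.Nat using (zero; _+_; _*_; _∸_; _≤_; _<_; z≤n; s≤s; pred; _<?_; _≡ᵇ_)
  open import Data.Nat.Properties
  open import Data.Nat.Induction using (<-rec)
  open import Data.Nat.ListAction using (sum)
  open import Data.Nat.ListAction.Properties using (sum-++)
  open import Data.Nat.Tactic.RingSolver using (solve-∀)
  open import Data.Bool using (Bool; true; false; T; T?; _∧_)
  open import Data.Bool.ListAction using (any)
  open import Data.Bool.Properties using (T-∧)
  open import Data.List using (List; []; _∷_; _++_; [_]; _∷ʳ_; length; map; upTo; applyUpTo; filterᵇ)
  open import Data.List.Properties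
    using (map-++; length-++; upTo-∷ʳ; applyUpTo-∷ʳ; length-applyUpTo; map-cong-local; map-applyUpTo;
           filter-++; filter-none)
  open import Data.List.Relation.Unary.All as All using (All; []; _∷_)
  import Data.List.Relation.Unary.All.Properties as All
  open import Data.List.Relation.Unary.Any using (here)
  open import Data.List.Relation.Unary.Any.Properties using (any⁺; any⁻)
  open import Data.List.Membership.Propositional using (_∈_; find; lose)
  open import Data.List.Membership.Propositional.Properties
    using (∈-map⁺; ∈-map⁻; ∈-++⁺ˡ; ∈-++⁺ʳ; ∈-++⁻; ∈-filter⁺; ∈-filter⁻)
  open import Data.Product using (Σ; ∃; _×_; _,_; proj₁; proj₂)
  open import Data.Sum using (_⊎_; inj₁; inj₂)
  open import Data.Unit using (tt)
  open import Data.Empty using (⊥-elim)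
  open import Function using (_∘_; id; _⇔_; mk⇔; Equivalence)
  open import Relation.Nullary using (yes; no; ¬_)
  open import Relation.Binary.PropositionalEquality
    using (_≡_; refl; sym; trans; cong; cong₂; subst; module ≡-Reasoning)

  -- Doubling by a recursion that computes on constructors, and the view of
  -- a natural number as even or odd.
  double : ℕ → ℕ
  double zero = zero
  double (suc j) = suc (suc (double j))

  double≡2* : ∀ j → double j ≡ 2 * j
  double≡2* zero = refl
  double≡2* (suc j) = cong suc (trans (cong suc (double≡2* j)) (sym (+-suc j (j + 0))))

  double-mono : ∀ {i j} → i ≤ j → double i ≤ double j
  double-mono z≤n = z≤n
  double-mono (s≤s i≤j) = s≤s (s≤s (double-mono i≤j))

  data Parity : ℕ → Set where
    even : ∀ j → Parity (double j)
    odd  : ∀ j → Parity (suc (double j))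

  parity : ∀ N → Parity N
  parity zero = even 0
  parity (suc N) with parity N
  ... | even j = odd j
  ... | odd j = even (suc j)

  bin-double : ∀ j → bin (double j) ≡ j
  bin-double zero = refl
  bin-double (suc j) = cong suc (bin-double j)

  bin-suc-double : ∀ j → bin (suc (double j)) ≡ suc j
  bin-suc-double zero = refl
  bin-suc-double (suc j) = cong suc (bin-suc-double j)

  ≤-double-bin : ∀ i → i ≤ double (bin i)
  ≤-double-bin zero = z≤n
  ≤-double-bin (suc zero) = s≤s z≤n
  ≤-double-bin (suc (suc i)) = s≤s (s≤s (≤-double-bin i))

  bin-pos : ∀ {i} → 1 ≤ i → 1 ≤ bin i
  bin-pos {suc zero} _ = s≤s z≤n
  bin-pos {suc (suc i)} _ = s≤s z≤n

  -- Gap i ℓ: index i may directly precede index ℓ in a legal decomposition.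
  Gap : ℕ → ℕ → Set
  Gap i ℓ = 2 + bin i ≤ bin ℓ

  -- Gaps compose, so the gap condition between neighbours spreads to all pairs.
  gap-trans : ∀ {i j ℓ} → Gap i j → Gap j ℓ → Gap i ℓ
  gap-trans {j = j} g₁ g₂ = ≤-trans g₁ (≤-trans (m≤n+m (bin j) 2) g₂)

  -- maxPrev ℓ = 2(⌈ℓ/2⌉ − 2) is the largest index that may precede ℓ:
  -- for i ≥ 1, Gap i ℓ holds exactly when i ≤ maxPrev ℓ.
  maxPrev : ℕ → ℕ
  maxPrev ℓ = double (bin ℓ ∸ 2)

  gap⇒≤maxPrev : ∀ {i ℓ} → Gap i ℓ → i ≤ maxPrev ℓ
  gap⇒≤maxPrev {i} {ℓ} g = ≤-trans (≤-double-bin i) (double-mono bin-i≤)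
    where
    bin-i≤ : bin i ≤ bin ℓ ∸ 2
    bin-i≤ = ≤-trans (≤-reflexive (sym (m+n∸m≡n 2 (bin i)))) (∸-monoˡ-≤ 2 g)

  ≤maxPrev⇒gap : ∀ {i ℓ} → 1 ≤ i → i ≤ maxPrev ℓ → Gap i ℓ
  ≤maxPrev⇒gap {i} {ℓ} 1≤i i≤ =
    ≤-trans (+-monoʳ-≤ 2 bin-i≤) (≤-reflexive (m+[n∸m]≡n 2≤bin-ℓ))
    where
    bin-i≤ : bin i ≤ bin ℓ ∸ 2
    bin-i≤ = ≤-trans (⌈n/2⌉-mono i≤) (≤-reflexive (bin-double (bin ℓ ∸ 2)))
    2≤bin-ℓ : 2 ≤ bin ℓ
    2≤bin-ℓ with bin ℓ | ≤-trans (bin-pos 1≤i) bin-i≤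
    ... | suc (suc _) | _ = s≤s (s≤s z≤n)

  maxPrev-< : ∀ N → maxPrev (suc N) ≤ N
  maxPrev-< zero = z≤n
  maxPrev-< (suc zero) = z≤n
  maxPrev-< (suc (suc N)) = ≤-trans (double-pred (bin (suc N))) (s≤s (s≤s (maxPrev-< N)))
    where
    double-pred : ∀ b → double (b ∸ 1) ≤ 2 + double (b ∸ 2)
    double-pred zero = z≤n
    double-pred (suc zero) = z≤n
    double-pred (suc (suc b)) = ≤-refl

  maxPrev-odd : ∀ j → maxPrev (suc (double j)) ≡ double (j ∸ 1)
  maxPrev-odd j = cong (λ b → double (b ∸ 2)) (bin-suc-double j)

  maxPrev-even : ∀ j → maxPrev (double (suc j)) ≡ double (j ∸ 1)
  maxPrev-even j = cong (λ b → double (suc b ∸ 2)) (bin-double j)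

  -- seqK N is the closed description of a_{N+1}: 1, 2, 3, 4, 5, 8, 11, 16, …,
  -- determined by a_{N+4} = a_{N+2} + 2 a_N.  It is shown below to be the
  -- sequence `terms` of Defs.
  seqK : ℕ → ℕ
  seqK 0 = 1
  seqK 1 = 2
  seqK 2 = 3
  seqK 3 = 4
  seqK (suc (suc (suc (suc N)))) = seqK (suc (suc N)) + 2 * seqK N

  seqK-even : ∀ j → seqK (double (suc j)) ≡ seqK (double j) + 2 * seqK (double (j ∸ 1))
  seqK-even zero = refl
  seqK-even (suc j) = refl

  seqK-odd : ∀ j → seqK (suc (double j)) ≡ seqK (double j) + seqK (double (j ∸ 1))
  seqK-odd zero = refl
  seqK-odd (suc zero) = refl
  seqK-odd (suc (suc j)) = begin
      seqK (suc (double (suc j))) + 2 * seqK (suc (double j))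
    ≡⟨ cong₂ (λ x y → x + 2 * y) (seqK-odd (suc j)) (seqK-odd j) ⟩
      (x + y) + 2 * (y + z)
    ≡⟨ rearrange x y z ⟩
      (x + 2 * y) + (y + 2 * z)
    ≡⟨ cong ((x + 2 * y) +_) (sym (seqK-even j)) ⟩
      (x + 2 * y) + x
    ∎
    where
    open ≡-Reasoning
    x y z : ℕ
    x = seqK (double (suc j))
    y = seqK (double j)
    z = seqK (double (j ∸ 1))
    rearrange : ∀ x y z → (x + y) + 2 * (y + z) ≡ (x + 2 * y) + (y + 2 * z)
    rearrange = solve-∀

  -- The recurrence behind the greedy algorithm: a_{N+2} = a_{N+1} + a_{maxPrev(N+1)+1}.
  seqK-rec : ∀ N → seqK (suc N) ≡ seqK N + seqK (maxPrev (suc N))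
  seqK-rec N with parity N
  ... | even j = trans (seqK-odd j) (cong (λ i → seqK (double j) + seqK i) (sym (maxPrev-odd j)))
  ... | odd j = begin
      seqK (double (suc j))
    ≡⟨ seqK-even j ⟩
      seqK (double j) + 2 * seqK (double (j ∸ 1))
    ≡⟨ split (seqK (double j)) (seqK (double (j ∸ 1))) ⟩
      (seqK (double j) + seqK (double (j ∸ 1))) + seqK (double (j ∸ 1))
    ≡⟨ cong₂ (λ x i → x + seqK i) (sym (seqK-odd j)) (sym (maxPrev-even j)) ⟩
      seqK (suc (double j)) + seqK (maxPrev (double (suc j)))
    ∎
    where
    open ≡-Reasoning
    split : ∀ x y → x + 2 * y ≡ (x + y) + y
    split = solve-∀

  seqK-step : ∀ N → seqK N ≤ seqK (suc N)
  seqK-step N = ≤-trans (m≤m+n (seqK N) _) (≤-reflexive (sym (seqK-rec N)))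

  seqK-pos : ∀ N → 1 ≤ seqK N
  seqK-pos zero = s≤s z≤n
  seqK-pos (suc N) = ≤-trans (seqK-pos N) (seqK-step N)

  seqK-mono : ∀ {N M} → N ≤ M → seqK N ≤ seqK M
  seqK-mono {M = zero} z≤n = ≤-refl
  seqK-mono {N} {suc M} N≤ with m≤n⇒m<n∨m≡n N≤
  ... | inj₁ (s≤s N≤M) = ≤-trans (seqK-mono N≤M) (seqK-step M)
  ... | inj₂ refl = ≤-refl

  weight : ℕ → ℕ
  weight i = seqK (pred i)

  weightSum : List ℕ → ℕ
  weightSum S = sum (map weight S)

  weightSum-∷ʳ : ∀ S x → weightSum (S ∷ʳ x) ≡ weightSum S + weight x
  weightSum-∷ʳ S x = begin
      sum (map weight (S ++ [ x ]))
    ≡⟨ cong sum (map-++ weight S [ x ]) ⟩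
      sum (map weight S ++ [ weight x ])
    ≡⟨ sum-++ (map weight S) [ weight x ] ⟩
      weightSum S + (weight x + 0)
    ≡⟨ cong (weightSum S +_) (+-identityʳ (weight x)) ⟩
      weightSum S + weight x
    ∎
    where open ≡-Reasoning

  length-∷ʳ : ∀ (S : List ℕ) x → length (S ∷ʳ x) ≡ suc (length S)
  length-∷ʳ S x = trans (length-++ S) (+-comm (length S) 1)

  -- Legal N S: S is an increasing legal index list drawn from 1 … N, described
  -- through its largest possible element: N is either unused, or it is the last
  -- element and the others form a legal list drawn from 1 … maxPrev N.
  data Legal : ℕ → List ℕ → Set where
    nil  : ∀ {N} → Legal N []
    skip : ∀ {N S} → Legal N S → Legal (suc N) S
    take : ∀ {N S} → Legal (maxPrev (suc N)) S → Legal (suc N) (S ∷ʳ suc N)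

  legal-range : ∀ {N S} → Legal N S → All (λ i → 1 ≤ i × i ≤ N) S
  legal-range nil = []
  legal-range (skip L) = All.map (λ (1≤i , i≤N) → 1≤i , m≤n⇒m≤1+n i≤N) (legal-range L)
  legal-range {suc N} (take L) =
    All.∷ʳ⁺ (All.map (λ (1≤i , i≤) → 1≤i , m≤n⇒m≤1+n (≤-trans i≤ (maxPrev-< N)))
                     (legal-range L))
            (s≤s z≤n , ≤-refl)

  weightSum-< : ∀ {N S} → Legal N S → weightSum S < seqK N
  weightSum-< {N} nil = seqK-pos N
  weightSum-< (skip {N} L) = <-≤-trans (weightSum-< L) (seqK-step N)
  weightSum-< {suc N} (take {S = S} L) = begin-strict
      weightSum (S ∷ʳ suc N)
    ≡⟨ weightSum-∷ʳ S (suc N) ⟩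
      weightSum S + seqK N
    <⟨ +-monoˡ-< (seqK N) (weightSum-< L) ⟩
      seqK (maxPrev (suc N)) + seqK N
    ≡⟨ +-comm _ (seqK N) ⟩
      seqK N + seqK (maxPrev (suc N))
    ≡⟨ sym (seqK-rec N) ⟩
      seqK (suc N)
    ∎
    where open ≤-Reasoning

  top-≤ : ∀ N S → seqK N ≤ weightSum (S ∷ʳ suc N)
  top-≤ N S = ≤-trans (m≤n+m (seqK N) (weightSum S))
                      (≤-reflexive (sym (weightSum-∷ʳ S (suc N))))

  Representable : ℕ → Set
  Representable N = ∀ m → m < seqK N → Σ (List ℕ) λ S → Legal N S × weightSum S ≡ m

  greedy : ∀ N → Representable N
  greedy = <-rec Representable step
    where
    step : ∀ N → (∀ {N′} → N′ < N → Representable N′) → Representable N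
    step zero _ zero _ = [] , nil , refl
    step zero _ (suc m) (s≤s ())
    step (suc N) rec m m< with m <? seqK N
    ... | yes m<′ with rec ≤-refl m m<′
    ...   | S , L , S≡m = S , skip L , S≡m
    step (suc N) rec m m< | no m≮ with rec (s≤s (maxPrev-< N)) (m ∸ seqK N) rest<
      where
      rest< : m ∸ seqK N < seqK (maxPrev (suc N))
      rest< = subst (m ∸ seqK N <_) (m+n∸m≡n (seqK N) _)
                (∸-monoˡ-< (subst (m <_) (seqK-rec N) m<) (≮⇒≥ m≮))
    ... | S , L , S≡rest = S ∷ʳ suc N , take L ,
          trans (weightSum-∷ʳ S (suc N)) (trans (cong (_+ seqK N) S≡rest) (m∸n+n≡m (≮⇒≥ m≮)))

  weaken : ∀ {N M S} → Legal N S → N ≤ M → Legal M S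
  weaken {M = zero} L z≤n = L
  weaken {N} {suc M} L N≤ with m≤n⇒m<n∨m≡n N≤
  ... | inj₁ (s≤s N≤M) = skip (weaken L N≤M)
  ... | inj₂ refl = L

  restrict : ∀ {M S} → Legal M S → ∀ N → N ≤ M → weightSum S < seqK N → Legal N S
  restrict nil N _ _ = nil
  restrict {suc M} (skip L) N N≤ S< with m≤n⇒m<n∨m≡n N≤
  ... | inj₁ (s≤s N≤M) = restrict L N N≤M S<
  ... | inj₂ refl = skip L
  restrict {suc M} (take {S = S} L) N N≤ S< with m≤n⇒m<n∨m≡n N≤
  ... | inj₁ (s≤s N≤M) = ⊥-elim (<⇒≱ S< (≤-trans (seqK-mono N≤M) (top-≤ M S)))
  ... | inj₂ refl = take L

  restrictBelow : ∀ {M S} → Legal M S → ∀ c → c ≤ M → All (_≤ c) S → Legal c S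
  restrictBelow nil c _ _ = nil
  restrictBelow {suc M} (skip L) c c≤ S≤c with m≤n⇒m<n∨m≡n c≤
  ... | inj₁ (s≤s c≤M) = restrictBelow L c c≤M S≤c
  ... | inj₂ refl = skip L
  restrictBelow {suc M} (take {S = S} L) c c≤ S≤c with m≤n⇒m<n∨m≡n c≤
  ... | inj₁ (s≤s c≤M) = ⊥-elim (<⇒≱ (s≤s c≤M) (proj₂ (All.∷ʳ⁻ S≤c)))
  ... | inj₂ refl = take L

  uses-top : ∀ {N S} → Legal (suc N) S → seqK N ≤ weightSum S →
             Σ (List ℕ) λ S′ → S ≡ S′ ∷ʳ suc N × Legal (maxPrev (suc N)) S′
  uses-top {N} nil a≤ = ⊥-elim (<⇒≱ (seqK-pos N) a≤)
  uses-top (skip L) a≤ = ⊥-elim (<⇒≱ (weightSum-< L) a≤)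
  uses-top (take {S = S′} L) _ = S′ , refl , L

  data _⊑_ : List ℕ → List ℕ → Set where
    []   : [] ⊑ []
    keep : ∀ {x S xs} → S ⊑ xs → (x ∷ S) ⊑ (x ∷ xs)
    drop : ∀ {x S xs} → S ⊑ xs → S ⊑ (x ∷ xs)

  ⊑⇒∈sublists : ∀ {S xs} → S ⊑ xs → S ∈ sublists xs
  ⊑⇒∈sublists [] = here refl
  ⊑⇒∈sublists (keep {x} S⊑) = ∈-++⁺ˡ (∈-map⁺ (x ∷_) (⊑⇒∈sublists S⊑))
  ⊑⇒∈sublists (drop {x} {xs = xs} S⊑) =
    ∈-++⁺ʳ (map (x ∷_) (sublists xs)) (⊑⇒∈sublists S⊑)

  ∈sublists⇒⊑ : ∀ {S} xs → S ∈ sublists xs → S ⊑ xs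
  ∈sublists⇒⊑ [] (here refl) = []
  ∈sublists⇒⊑ (x ∷ xs) S∈ with ∈-++⁻ (map (x ∷_) (sublists xs)) S∈
  ... | inj₁ S∈map with ∈-map⁻ (x ∷_) S∈map
  ...   | _ , S′∈ , refl = keep (∈sublists⇒⊑ xs S′∈)
  ∈sublists⇒⊑ (x ∷ xs) S∈ | inj₂ S∈′ = drop (∈sublists⇒⊑ xs S∈′)

  []⊑ : ∀ xs → [] ⊑ xs
  []⊑ [] = []
  []⊑ (x ∷ xs) = drop ([]⊑ xs)

  ⊑[] : ∀ {S} → S ⊑ [] → S ≡ []
  ⊑[] [] = refl

  ⊑-++ʳ : ∀ {S xs} ys → S ⊑ xs → S ⊑ (xs ++ ys)
  ⊑-++ʳ ys [] = []⊑ ys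
  ⊑-++ʳ ys (keep S⊑) = keep (⊑-++ʳ ys S⊑)
  ⊑-++ʳ ys (drop S⊑) = drop (⊑-++ʳ ys S⊑)

  ∷ʳ-⊑ : ∀ {S xs} x → S ⊑ xs → (S ∷ʳ x) ⊑ (xs ∷ʳ x)
  ∷ʳ-⊑ x [] = keep []
  ∷ʳ-⊑ x (keep S⊑) = keep (∷ʳ-⊑ x S⊑)
  ∷ʳ-⊑ x (drop S⊑) = drop (∷ʳ-⊑ x S⊑)

  ⊑-∷ʳ⁻ : ∀ {S} xs x → S ⊑ (xs ∷ʳ x) →
          S ⊑ xs ⊎ Σ (List ℕ) λ S′ → S ≡ S′ ∷ʳ x × S′ ⊑ xs
  ⊑-∷ʳ⁻ [] x (keep S⊑) with ⊑[] S⊑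
  ... | refl = inj₂ ([] , refl , [])
  ⊑-∷ʳ⁻ [] x (drop S⊑) with ⊑[] S⊑
  ... | refl = inj₁ []
  ⊑-∷ʳ⁻ (y ∷ xs) x (keep S⊑) with ⊑-∷ʳ⁻ xs x S⊑
  ... | inj₁ S⊑′ = inj₁ (keep S⊑′)
  ... | inj₂ (S′ , refl , S′⊑) = inj₂ (y ∷ S′ , refl , keep S′⊑)
  ⊑-∷ʳ⁻ (y ∷ xs) x (drop S⊑) with ⊑-∷ʳ⁻ xs x S⊑
  ... | inj₁ S⊑′ = inj₁ (drop S⊑′)
  ... | inj₂ (S′ , refl , S′⊑) = inj₂ (S′ , refl , drop S′⊑)

  indices-suc : ∀ M → indices (suc M) ≡ indices M ∷ʳ suc M
  indices-suc M = trans (cong (map suc) (sym (upTo-∷ʳ M))) (map-++ suc (upTo M) [ M ])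

  ⊑-indices-mono : ∀ {c N S} → c ≤ N → S ⊑ indices c → S ⊑ indices N
  ⊑-indices-mono {N = zero} z≤n S⊑ = S⊑
  ⊑-indices-mono {c} {suc N} c≤ S⊑ with m≤n⇒m<n∨m≡n c≤
  ... | inj₁ (s≤s c≤N) =
    subst (_ ⊑_) (sym (indices-suc N)) (⊑-++ʳ [ suc N ] (⊑-indices-mono c≤N S⊑))
  ... | inj₂ refl = S⊑

  legal-∷ʳ⁺ : ∀ S x → T (legal S) → All (λ i → Gap i x) S → T (legal (S ∷ʳ x))
  legal-∷ʳ⁺ [] x _ _ = tt
  legal-∷ʳ⁺ (y ∷ []) x _ (g ∷ []) = Equivalence.from T-∧ (≤⇒≤ᵇ g , tt)
  legal-∷ʳ⁺ (y ∷ z ∷ S) x l (_ ∷ gaps) with Equivalence.to T-∧ l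
  ... | g , l′ = Equivalence.from T-∧ (g , legal-∷ʳ⁺ (z ∷ S) x l′ gaps)

  legal-∷ʳ⁻ : ∀ S x → T (legal (S ∷ʳ x)) → T (legal S) × All (λ i → Gap i x) S
  legal-∷ʳ⁻ [] x _ = tt , []
  legal-∷ʳ⁻ (y ∷ []) x l = tt , ≤ᵇ⇒≤ _ _ (proj₁ (Equivalence.to T-∧ l)) ∷ []
  legal-∷ʳ⁻ (y ∷ z ∷ S) x l =
    let g , l′ = Equivalence.to T-∧ l
        l″ , gaps = legal-∷ʳ⁻ (z ∷ S) x l′
    in Equivalence.from T-∧ (g , l″) , gap-trans (≤ᵇ⇒≤ _ _ g) (All.head gaps) ∷ gaps

  Legal⇒ : ∀ {M S} → Legal M S → S ⊑ indices M × T (legal S)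
  Legal⇒ {M} nil = []⊑ (indices M) , tt
  Legal⇒ (skip {N} L) with Legal⇒ L
  ... | S⊑ , l = ⊑-indices-mono (n≤1+n N) S⊑ , l
  Legal⇒ (take {N} {S} L) with Legal⇒ L
  ... | S⊑ , l =
    subst ((S ∷ʳ suc N) ⊑_) (sym (indices-suc N))
          (∷ʳ-⊑ (suc N) (⊑-indices-mono (maxPrev-< N) S⊑)) ,
    legal-∷ʳ⁺ S (suc N) l (All.map (λ (1≤i , i≤) → ≤maxPrev⇒gap 1≤i i≤) (legal-range L))

  ⇒Legal : ∀ M {S} → S ⊑ indices M → T (legal S) → Legal M S
  ⇒Legal zero S⊑ _ with ⊑[] S⊑
  ... | refl = nil
  ⇒Legal (suc M) S⊑ l with ⊑-∷ʳ⁻ (indices M) (suc M) (subst (_ ⊑_) (indices-suc M) S⊑)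
  ... | inj₁ S⊑′ = skip (⇒Legal M S⊑′ l)
  ... | inj₂ (S′ , refl , S′⊑) with legal-∷ʳ⁻ S′ (suc M) l
  ...   | l′ , gaps = take (restrictBelow (⇒Legal M S′⊑ l′) (maxPrev (suc M)) (maxPrev-< M)
                                          (All.map gap⇒≤maxPrev gaps))

  ∈legalSets⇒ : ∀ ts {S} → S ∈ legalSets ts → Legal (length ts) S
  ∈legalSets⇒ ts S∈ with ∈-filter⁻ (T? ∘ legal) {xs = sublists (indices (length ts))} S∈
  ... | S∈′ , l = ⇒Legal (length ts) (∈sublists⇒⊑ _ S∈′) l

  ⇒∈legalSets : ∀ ts {S} → Legal (length ts) S → S ∈ legalSets ts
  ⇒∈legalSets ts L with Legal⇒ L
  ... | S⊑ , l = ∈-filter⁺ (T? ∘ legal) (⊑⇒∈sublists S⊑) l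

  prefix : ℕ → List ℕ
  prefix N = applyUpTo seqK N

  val-applyUpTo : ∀ (f : ℕ → ℕ) n i → 1 ≤ i → i ≤ n → val (applyUpTo f n) i ≡ f (pred i)
  val-applyUpTo f (suc n) (suc zero) _ _ = refl
  val-applyUpTo f (suc n) (suc (suc i)) _ (s≤s i<n) =
    val-applyUpTo (f ∘ suc) n (suc i) (s≤s z≤n) i<n

  value-prefix : ∀ {N S} → Legal N S → value (prefix N) S ≡ weightSum S
  value-prefix {N} L =
    cong sum (map-cong-local (All.map (λ (1≤i , i≤N) → val-applyUpTo seqK N _ 1≤i i≤N)
                                      (legal-range L)))

  legalSets-prefix⇒ : ∀ {N S} → S ∈ legalSets (prefix N) → Legal N S
  legalSets-prefix⇒ {N} S∈ =
    subst (λ n → Legal n _) (length-applyUpTo seqK N) (∈legalSets⇒ (prefix N) S∈)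

  ⇒legalSets-prefix : ∀ {N S} → Legal N S → S ∈ legalSets (prefix N)
  ⇒legalSets-prefix {N} L =
    ⇒∈legalSets (prefix N) (subst (λ n → Legal n _) (sym (length-applyUpTo seqK N)) L)

  any-witness : ∀ {A : Set} (p : A → Bool) xs → T (any p xs) → ∃ λ x → x ∈ xs × T (p x)
  any-witness p xs = find ∘ any⁻ p xs

  witness-any : ∀ {A : Set} (p : A → Bool) {x xs} → x ∈ xs → T (p x) → T (any p xs)
  witness-any p x∈ px = any⁺ p (lose x∈ px)

  hasDecomp-prefix⇒ : ∀ N m → T (hasDecomp (prefix N) m) → m < seqK N
  hasDecomp-prefix⇒ N m h with any-witness _ (legalSets (prefix N)) h
  ... | S , S∈ , S≡m =
    subst (_< seqK N) (trans (sym (value-prefix L)) (≡ᵇ⇒≡ _ _ S≡m)) (weightSum-< L)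
    where L = legalSets-prefix⇒ {N} S∈

  ⇒hasDecomp-prefix : ∀ N m → m < seqK N → T (hasDecomp (prefix N) m)
  ⇒hasDecomp-prefix N m m< with greedy N m m<
  ... | S , L , S≡m =
    witness-any _ (⇒legalSets-prefix L) (≡⇒≡ᵇ _ _ (trans (value-prefix L) S≡m))

  findFrom-first : ∀ ts f m t → m ≤ t → t ≤ m + f →
                   (∀ j → m ≤ j → j < t → T (hasDecomp ts j)) → ¬ T (hasDecomp ts t) →
                   findFrom ts f m ≡ t
  findFrom-first ts zero m t m≤t t≤ _ _ = ≤-antisym m≤t (subst (t ≤_) (+-identityʳ m) t≤)
  findFrom-first ts (suc f) m t m≤t t≤ below ¬t with m≤n⇒m<n∨m≡n m≤t
  ... | inj₁ m<t with hasDecomp ts m | below m ≤-refl m<t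
  ...   | true | _ = findFrom-first ts f (suc m) t m<t (subst (t ≤_) (+-suc m f) t≤)
                       (λ j m<j j<t → below j (≤-trans (n≤1+n m) m<j) j<t) ¬t
  findFrom-first ts (suc f) m t m≤t t≤ below ¬t | inj₂ refl with hasDecomp ts m | ¬t
  ... | false | _ = refl
  ... | true | ¬T = ⊥-elim (¬T tt)

  -- The search bound of `next` suffices: a_{N+1} ≤ 1 + a_1 + … + a_N.
  sum-prefix-suc : ∀ N → sum (prefix (suc N)) ≡ sum (prefix N) + seqK N
  sum-prefix-suc N = begin
      sum (prefix (suc N))
    ≡⟨ cong sum (sym (applyUpTo-∷ʳ seqK N)) ⟩
      sum (prefix N ∷ʳ seqK N)
    ≡⟨ sum-++ (prefix N) [ seqK N ] ⟩
      sum (prefix N) + (seqK N + 0)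
    ≡⟨ cong (sum (prefix N) +_) (+-identityʳ (seqK N)) ⟩
      sum (prefix N) + seqK N
    ∎
    where open ≡-Reasoning

  seqK-≤-sum : ∀ N → seqK N ≤ suc (sum (prefix N))
  seqK-≤-sum zero = ≤-refl
  seqK-≤-sum (suc N) = begin
      seqK (suc N)
    ≡⟨ seqK-rec N ⟩
      seqK N + seqK (maxPrev (suc N))
    ≤⟨ +-monoʳ-≤ (seqK N) (seqK-mono (maxPrev-< N)) ⟩
      seqK N + seqK N
    ≤⟨ +-monoʳ-≤ (seqK N) (seqK-≤-sum N) ⟩
      seqK N + suc (sum (prefix N))
    ≡⟨ +-comm (seqK N) _ ⟩
      suc (sum (prefix N) + seqK N)
    ≡⟨ cong suc (sym (sum-prefix-suc N)) ⟩
      suc (sum (prefix (suc N)))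
    ∎
    where open ≤-Reasoning

  next-prefix : ∀ N → next (prefix N) ≡ seqK N
  next-prefix N =
    findFrom-first (prefix N) (sum (prefix N)) 1 (seqK N) (seqK-pos N) (seqK-≤-sum N)
      (λ j _ j< → ⇒hasDecomp-prefix N j j<)
      (λ h → <-irrefl refl (hasDecomp-prefix⇒ N (seqK N) h))

  terms≡prefix : ∀ N → terms N ≡ prefix N
  terms≡prefix zero = refl
  terms≡prefix (suc N) = begin
      terms N ∷ʳ next (terms N)
    ≡⟨ cong (λ ts → ts ∷ʳ next ts) (terms≡prefix N) ⟩
      prefix N ∷ʳ next (prefix N)
    ≡⟨ cong (prefix N ∷ʳ_) (next-prefix N) ⟩
      prefix N ∷ʳ seqK N
    ≡⟨ applyUpTo-∷ʳ seqK N ⟩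
      prefix (suc N)
    ∎
    where open ≡-Reasoning

  a-odd : ∀ n → a (suc (2 * n)) ≡ seqK (double n)
  a-odd n = begin
      val (terms (suc (2 * n))) (suc (2 * n))
    ≡⟨ cong (λ ts → val ts (suc (2 * n))) (terms≡prefix (suc (2 * n))) ⟩
      val (prefix (suc (2 * n))) (suc (2 * n))
    ≡⟨ val-applyUpTo seqK (suc (2 * n)) (suc (2 * n)) (s≤s z≤n) ≤-refl ⟩
      seqK (2 * n)
    ≡⟨ cong seqK (sym (double≡2* n)) ⟩
      seqK (double n)
    ∎
    where open ≡-Reasoning

  Decomp : ℕ → ℕ → ℕ → Set
  Decomp M m k = Σ (List ℕ) λ S → Legal M S × weightSum S ≡ m × length S ≡ k

  -- The test hasDecompWith of Defs decides Decomp; HasDecompWithin k m ts is that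
  -- test as a property of the list of terms ts, so that terms M can be replaced.
  HasDecompWithin : ℕ → ℕ → List ℕ → Set
  HasDecompWithin k m ts = T (any (λ S → (value ts S ≡ᵇ m) ∧ (length S ≡ᵇ k)) (legalSets ts))

  hasDecompWith⇒ : ∀ M k m → T (hasDecompWith M k m) → Decomp M m k
  hasDecompWith⇒ M k m h
    with any-witness _ (legalSets (prefix M)) (subst (HasDecompWithin k m) (terms≡prefix M) h)
  ... | S , S∈ , test =
    let L = legalSets-prefix⇒ {M} S∈
        S≡m , len≡k = Equivalence.to T-∧ test
    in S , L , trans (sym (value-prefix L)) (≡ᵇ⇒≡ _ _ S≡m) , ≡ᵇ⇒≡ _ _ len≡k

  ⇒hasDecompWith : ∀ M k m → Decomp M m k → T (hasDecompWith M k m)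
  ⇒hasDecompWith M k m (S , L , S≡m , len≡k) =
    subst (HasDecompWithin k m) (sym (terms≡prefix M))
      (witness-any _ (⇒legalSets-prefix L)
        (Equivalence.from T-∧ (≡⇒≡ᵇ _ _ (trans (value-prefix L) S≡m) , ≡⇒≡ᵇ _ _ len≡k)))

  Decomp-0-summands : ∀ {M m} → Decomp M m 0 → m ≡ 0
  Decomp-0-summands ([] , _ , refl , _) = refl

  Decomp-of-0 : ∀ {M k} → Decomp M 0 k → k ≡ 0
  Decomp-of-0 ([] , _ , _ , refl) = refl
  Decomp-of-0 (i ∷ S , _ , S≡0 , _) =
    ⊥-elim (<⇒≢ (≤-trans (seqK-pos (pred i)) (m≤m+n _ _)) (sym S≡0))

  Decomp-shift⁺ : ∀ {M N j k} → suc N ≤ M → j < seqK (maxPrev (suc N)) →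
                  Decomp M (seqK N + j) (suc k) → Decomp M j k
  Decomp-shift⁺ {M} {N} {j} N< j< (S , L , S≡ , len)
    with uses-top (restrict L (suc N) N< S<) (subst (seqK N ≤_) (sym S≡) (m≤m+n (seqK N) j))
    where
    S< : weightSum S < seqK (suc N)
    S< = subst (weightSum S <_) (sym (seqK-rec N))
               (subst (_< seqK N + _) (sym S≡) (+-monoʳ-< (seqK N) j<))
  ... | S′ , refl , L′ =
    S′ , weaken L′ (≤-trans (maxPrev-< N) (≤-trans (n≤1+n N) N<)) ,
    +-cancelˡ-≡ (seqK N) _ _
      (trans (+-comm (seqK N) _) (trans (sym (weightSum-∷ʳ S′ (suc N))) S≡)) ,
    suc-injective (trans (sym (length-∷ʳ S′ (suc N))) len)

  Decomp-shift⁻ : ∀ {M N j k} → suc N ≤ M → j < seqK (maxPrev (suc N)) →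
                  Decomp M j k → Decomp M (seqK N + j) (suc k)
  Decomp-shift⁻ {M} {N} {j} N< j< (S , L , S≡ , len) =
    S ∷ʳ suc N ,
    weaken (take (restrict L (maxPrev (suc N)) (≤-trans (maxPrev-< N) (≤-trans (n≤1+n N) N<))
                           (subst (_< seqK (maxPrev (suc N))) (sym S≡) j<))) N< ,
    trans (weightSum-∷ʳ S (suc N)) (trans (cong (_+ seqK N) S≡) (+-comm j (seqK N))) ,
    trans (length-∷ʳ S (suc N)) (cong suc len)

  countᵇ : (ℕ → Bool) → List ℕ → ℕ
  countᵇ p xs = length (filterᵇ p xs)

  countᵇ-++ : ∀ p xs ys → countᵇ p (xs ++ ys) ≡ countᵇ p xs + countᵇ p ys
  countᵇ-++ p xs ys = trans (cong length (filter-++ (T? ∘ p) xs ys)) (length-++ (filterᵇ p xs))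

  countᵇ-map : ∀ p f xs → countᵇ p (map f xs) ≡ countᵇ (p ∘ f) xs
  countᵇ-map p f [] = refl
  countᵇ-map p f (x ∷ xs) with p (f x)
  ... | true = cong suc (countᵇ-map p f xs)
  ... | false = countᵇ-map p f xs

  countᵇ-cong : ∀ p q xs → All (λ x → T (p x) ⇔ T (q x)) xs → countᵇ p xs ≡ countᵇ q xs
  countᵇ-cong p q [] [] = refl
  countᵇ-cong p q (x ∷ xs) (px⇔qx ∷ rest) with p x | q x | px⇔qx
  ... | true | true | _ = cong suc (countᵇ-cong p q xs rest)
  ... | false | false | _ = countᵇ-cong p q xs rest
  ... | true | false | e = ⊥-elim (Equivalence.to e tt)
  ... | false | true | e = ⊥-elim (Equivalence.from e tt)

  countᵇ-none : ∀ p xs → All (λ x → ¬ T (p x)) xs → countᵇ p xs ≡ 0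
  countᵇ-none p xs none = cong length (filter-none (T? ∘ p) none)

  applyUpTo-+ : ∀ (f : ℕ → ℕ) m n →
                applyUpTo f (m + n) ≡ applyUpTo f m ++ applyUpTo (f ∘ (m +_)) n
  applyUpTo-+ f zero n = refl
  applyUpTo-+ f (suc m) n = cong (f 0 ∷_) (applyUpTo-+ (f ∘ suc) m n)

  upTo-+ : ∀ m n → upTo (m + n) ≡ upTo m ++ map (m +_) (upTo n)
  upTo-+ m n = trans (applyUpTo-+ id m n) (cong (upTo m ++_) (sym (map-applyUpTo id (m +_) n)))

  count : ℕ → ℕ → ℕ → ℕ
  count M N k = countᵇ (hasDecompWith M k) (upTo (seqK N))

  -- The coefficients of y·F(y), given those of F(y).
  timesY : (ℕ → ℕ) → ℕ → ℕ
  timesY f zero = 0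
  timesY f (suc k) = f k

  timesY-cong : ∀ {f g : ℕ → ℕ} → (∀ k → f k ≡ g k) → ∀ k → timesY f k ≡ timesY g k
  timesY-cong f≡g zero = refl
  timesY-cong f≡g (suc k) = f≡g k

  -- Splitting [0, a_{N+2}) at a_{N+1}: the upper part a_{N+1} + [0, a_{maxPrev(N+1)+1})
  -- contributes the counts for maxPrev(N+1), shifted by one summand.
  count-rec : ∀ M N → suc N ≤ M → ∀ k →
              count M (suc N) k ≡ count M N k + timesY (count M (maxPrev (suc N))) k
  count-rec M N N< k = begin
      countᵇ (HD k) (upTo (seqK (suc N)))
    ≡⟨ cong (countᵇ (HD k) ∘ upTo) (seqK-rec N) ⟩
      countᵇ (HD k) (upTo (seqK N + r))
    ≡⟨ cong (countᵇ (HD k)) (upTo-+ (seqK N) r) ⟩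
      countᵇ (HD k) (upTo (seqK N) ++ map (seqK N +_) (upTo r))
    ≡⟨ countᵇ-++ (HD k) (upTo (seqK N)) _ ⟩
      count M N k + countᵇ (HD k) (map (seqK N +_) (upTo r))
    ≡⟨ cong (count M N k +_) (countᵇ-map (HD k) (seqK N +_) (upTo r)) ⟩
      count M N k + countᵇ (HD k ∘ (seqK N +_)) (upTo r)
    ≡⟨ cong (count M N k +_) (upper k) ⟩
      count M N k + timesY (count M (maxPrev (suc N))) k
    ∎
    where
    open ≡-Reasoning
    HD : ℕ → ℕ → Bool
    HD k = hasDecompWith M k
    r : ℕ
    r = seqK (maxPrev (suc N))
    no-empty : ∀ j → ¬ T (HD 0 (seqK N + j))
    no-empty j h = <⇒≢ (≤-trans (seqK-pos N) (m≤m+n _ _))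
                       (sym (Decomp-0-summands (hasDecompWith⇒ M 0 _ h)))
    remove-top : ∀ {k j} → j < r → T (HD (suc k) (seqK N + j)) ⇔ T (HD k j)
    remove-top {k} {j} j< = mk⇔
      (⇒hasDecompWith M k j ∘ Decomp-shift⁺ N< j< ∘ hasDecompWith⇒ M (suc k) _)
      (⇒hasDecompWith M (suc k) _ ∘ Decomp-shift⁻ N< j< ∘ hasDecompWith⇒ M k j)
    upper : ∀ k → countᵇ (HD k ∘ (seqK N +_)) (upTo r) ≡ timesY (count M (maxPrev (suc N))) k
    upper zero = countᵇ-none _ (upTo r) (All.map (λ {j} _ → no-empty j) (All.all-upTo r))
    upper (suc k) = countᵇ-cong _ _ (upTo r) (All.map remove-top (All.all-upTo r))

  -- pRec j k: the numbers p_{j,k}, generated by P_0 = 1 and P_{j+1} = P_j + 2y·P_{j−1}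
  -- (with P_{−1} read as P_0); the recursion is split so as to be structural.
  pRec : ℕ → ℕ → ℕ
  pRec _ zero = 1
  pRec zero (suc k) = 0
  pRec (suc zero) (suc k) = pRec zero (suc k) + 2 * pRec zero k
  pRec (suc (suc j)) (suc k) = pRec (suc j) (suc k) + 2 * pRec j k

  pRec-suc : ∀ j k → pRec (suc j) k ≡ pRec j k + 2 * timesY (pRec (j ∸ 1)) k
  pRec-suc j zero = refl
  pRec-suc zero (suc k) = refl
  pRec-suc (suc j) (suc k) = refl

  pRec-vanish : ∀ j k → j < k → pRec j k ≡ 0
  pRec-vanish zero (suc k) _ = refl
  pRec-vanish (suc zero) (suc zero) (s≤s ())
  pRec-vanish (suc zero) (suc (suc k)) _ = refl
  pRec-vanish (suc (suc j)) (suc k) (s≤s j<k)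
    rewrite pRec-vanish (suc j) (suc k) (m<n⇒m<1+n j<k)
          | pRec-vanish j k (<-trans (n<1+n j) j<k) = refl

  -- Below a_1 = 1 only 0 is counted, with no summands.
  count-base : ∀ M k → count M 0 k ≡ pRec 0 k
  count-base M zero with hasDecompWith M 0 0 | ⇒hasDecompWith M 0 0 ([] , nil , refl , refl)
  ... | true | _ = refl
  count-base M (suc k) with hasDecompWith M (suc k) 0 | hasDecompWith⇒ M (suc k) 0
  ... | false | _ = refl
  ... | true | decomp with () ← Decomp-of-0 (decomp tt)

  -- Two steps of count-rec: the counts below a_{2j+1} follow the recurrence of pRec.
  count-step : ∀ M j → double (suc j) ≤ M →
               (∀ k → count M (double j) k ≡ pRec j k) →
               (∀ k → count M (double (j ∸ 1)) k ≡ pRec (j ∸ 1) k) →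
               ∀ k → count M (double (suc j)) k ≡ pRec (suc j) k
  count-step M j j< ih ih′ k = begin
      count M (suc (suc (double j))) k
    ≡⟨ count-rec M (suc (double j)) j< k ⟩
      count M (suc (double j)) k + timesY (count M (maxPrev (double (suc j)))) k
    ≡⟨ cong₂ _+_ (count-rec M (double j) (≤-trans (n≤1+n _) j<) k)
                 (cong (λ i → timesY (count M i) k) (maxPrev-even j)) ⟩
      (count M (double j) k + timesY (count M (maxPrev (suc (double j)))) k)
        + timesY (count M (double (j ∸ 1))) k
    ≡⟨ cong (λ i → (count M (double j) k + timesY (count M i) k) + c) (maxPrev-odd j) ⟩
      (count M (double j) k + c) + c
    ≡⟨ cong₂ (λ x y → (x + y) + y) (ih k) (timesY-cong ih′ k) ⟩
      (pRec j k + d) + d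
    ≡⟨ double-add (pRec j k) d ⟩
      pRec j k + 2 * d
    ≡⟨ sym (pRec-suc j k) ⟩
      pRec (suc j) k
    ∎
    where
    open ≡-Reasoning
    c d : ℕ
    c = timesY (count M (double (j ∸ 1))) k
    d = timesY (pRec (j ∸ 1)) k
    double-add : ∀ x y → (x + y) + y ≡ x + 2 * y
    double-add = solve-∀

  count-double : ∀ M j → double j ≤ M → ∀ k → count M (double j) k ≡ pRec j k
  count-double M zero _ = count-base M
  count-double M (suc zero) 2≤M = count-step M 0 2≤M (count-base M) (count-base M)
  count-double M (suc (suc j)) j≤M =
    count-step M (suc j) j≤M
      (count-double M (suc j) (≤-trans (n≤1+n _) (≤-trans (n≤1+n _) j≤M)))
      (count-double M j (≤-trans (double-mono (≤-trans (n≤1+n j) (n≤1+n _))) j≤M))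

  p≡pRec : ∀ n k → p n k ≡ pRec n k
  p≡pRec n k = begin
      countᵇ (hasDecompWith (suc (2 * n)) k) (upTo (a (suc (2 * n))))
    ≡⟨ cong (countᵇ (hasDecompWith (suc (2 * n)) k) ∘ upTo) (a-odd n) ⟩
      count (suc (2 * n)) (double n) k
    ≡⟨ count-double (suc (2 * n)) n (≤-trans (≤-reflexive (double≡2* n)) (n≤1+n _)) k ⟩
      pRec n k
    ∎
    where open ≡-Reasoning

module ClosedForm {c ℓ} (R : CommutativeRing c ℓ) where

  open CommutativeRing R
  open RingOps R
  open Counting using (pRec; pRec-suc; pRec-vanish; timesY; p≡pRec)
  open import Data.Nat using (zero; _≤_; _<_; s≤s; z≤n) renaming (_+_ to _+ℕ_; _*_ to _*ℕ_)
  open import Data.Nat.Properties using (≤-trans; m≤m+n; n≤1+n; m≤n⇒m<n∨m≡n)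
  open import Data.Product using (_×_; _,_; proj₁)
  open import Data.Sum using (inj₁; inj₂)
  open import Function using (_∘_)
  import Relation.Binary.PropositionalEquality as ≡
  open import Relation.Binary.Reasoning.Setoid setoid
  open import Algebra.Solver.Ring.NaturalCoefficients.Default commutativeSemiring

  -- ι n as a solver polynomial; it denotes ι n definitionally.
  ι̂ : ∀ {m} → ℕ → Polynomial m
  ι̂ zero = con 0
  ι̂ (suc n) = con 1 :+ ι̂ n

  ι-+ : ∀ m n → ι (m +ℕ n) ≈ ι m + ι n
  ι-+ zero n = sym (+-identityˡ (ι n))
  ι-+ (suc m) n = trans (+-cong refl (ι-+ m n)) (sym (+-assoc 1# (ι m) (ι n)))

  ι-* : ∀ m n → ι (m *ℕ n) ≈ ι m * ι n
  ι-* zero n = sym (zeroˡ (ι n))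
  ι-* (suc m) n = begin
      ι (n +ℕ m *ℕ n)        ≈⟨ ι-+ n (m *ℕ n) ⟩
      ι n + ι (m *ℕ n)       ≈⟨ +-cong (sym (*-identityˡ (ι n))) (ι-* m n) ⟩
      1# * ι n + ι m * ι n   ≈⟨ distribʳ (ι n) 1# (ι m) ⟨
      (1# + ι m) * ι n       ∎

  sumTo-cong : ∀ K {f g : ℕ → Carrier} → (∀ k → f k ≈ g k) → sumTo K f ≈ sumTo K g
  sumTo-cong zero f≈g = f≈g 0
  sumTo-cong (suc K) f≈g = +-cong (sumTo-cong K f≈g) (f≈g (suc K))

  sumTo-+ : ∀ K (f g : ℕ → Carrier) → sumTo K (λ k → f k + g k) ≈ sumTo K f + sumTo K g
  sumTo-+ zero f g = refl
  sumTo-+ (suc K) f g = trans (+-cong (sumTo-+ K f g) refl)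
    (solve 4 (λ a b c d → (a :+ b) :+ (c :+ d) := (a :+ c) :+ (b :+ d)) refl
           (sumTo K f) (sumTo K g) (f (suc K)) (g (suc K)))

  sumTo-*ˡ : ∀ K x (f : ℕ → Carrier) → sumTo K (λ k → x * f k) ≈ x * sumTo K f
  sumTo-*ˡ zero x f = refl
  sumTo-*ˡ (suc K) x f =
    trans (+-cong (sumTo-*ˡ K x f) refl) (sym (distribˡ x (sumTo K f) (f (suc K))))

  sumTo-shift : ∀ K (f : ℕ → Carrier) → sumTo (suc K) f ≈ f 0 + sumTo K (f ∘ suc)
  sumTo-shift zero f = refl
  sumTo-shift (suc K) f = trans (+-cong (sumTo-shift K f) refl) (+-assoc (f 0) _ _)

  sumTo-extend : ∀ {K K′} (f : ℕ → Carrier) → (∀ k → K < k → f k ≈ 0#) → K ≤ K′ →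
                 sumTo K′ f ≈ sumTo K f
  sumTo-extend {K′ = zero} f _ z≤n = refl
  sumTo-extend {K} {suc K′} f vanish K≤ with m≤n⇒m<n∨m≡n K≤
  ... | inj₁ (s≤s K≤K′) = begin
      sumTo K′ f + f (suc K′)
        ≈⟨ +-cong (sumTo-extend f vanish K≤K′) (vanish (suc K′) (s≤s K≤K′)) ⟩
      sumTo K f + 0#
        ≈⟨ +-identityʳ (sumTo K f) ⟩
      sumTo K f
        ∎
  ... | inj₂ ≡.refl = refl

  Rec : Carrier → Carrier → (ℕ → Carrier) → Set ℓ
  Rec α β u = ∀ n → u (suc (suc n)) ≈ α * u (suc n) + β * u n

  rec-unique : ∀ {α β u v} → Rec α β u → Rec α β v →
               u 0 ≈ v 0 → u 1 ≈ v 1 → ∀ n → u n ≈ v n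
  rec-unique {α} {β} {u} {v} recu recv u0≈v0 u1≈v1 n = proj₁ (agree n)
    where
    agree : ∀ n → u n ≈ v n × u (suc n) ≈ v (suc n)
    agree zero = u0≈v0 , u1≈v1
    agree (suc n) with agree n
    ... | uₙ≈vₙ , uₙ₊₁≈vₙ₊₁ =
      uₙ₊₁≈vₙ₊₁ ,
      trans (recu n) (trans (+-cong (*-cong refl uₙ₊₁≈vₙ₊₁) (*-cong refl uₙ≈vₙ))
                            (sym (recv n)))

  rec-shift : ∀ {α β u} → Rec α β u → Rec α β (u ∘ suc)
  rec-shift recu n = recu (suc n)

  rec-scale : ∀ {α β u} x → Rec α β u → Rec α β (λ n → x * u n)
  rec-scale {α} {β} {u} x recu n = begin
      x * u (suc (suc n))
        ≈⟨ *-cong refl (recu n) ⟩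
      x * (α * u (suc n) + β * u n)
        ≈⟨ solve 5 (λ x α β a b → x :* (α :* a :+ β :* b) := α :* (x :* a) :+ β :* (x :* b))
                   refl x α β (u (suc n)) (u n) ⟩
      α * (x * u (suc n)) + β * (x * u n)
        ∎

  rec-+ : ∀ {α β u v} → Rec α β u → Rec α β v → Rec α β (λ n → u n + v n)
  rec-+ {α} {β} {u} {v} recu recv n = begin
      u (suc (suc n)) + v (suc (suc n))
        ≈⟨ +-cong (recu n) (recv n) ⟩
      (α * u (suc n) + β * u n) + (α * v (suc n) + β * v n)
        ≈⟨ solve 6 (λ α β a b c d → (α :* a :+ β :* b) :+ (α :* c :+ β :* d)
                      := α :* (a :+ c) :+ β :* (b :+ d))
                   refl α β (u (suc n)) (u n) (v (suc n)) (v n) ⟩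
      α * (u (suc n) + v (suc n)) + β * (u n + v n)
        ∎

  rec-pow : ∀ {α β} b → b * b ≈ α * b + β → Rec α β (b ^′_)
  rec-pow {α} {β} b root n = begin
      b * (b * b ^′ n)
        ≈⟨ *-assoc b b (b ^′ n) ⟨
      (b * b) * b ^′ n
        ≈⟨ *-cong root refl ⟩
      (α * b + β) * b ^′ n
        ≈⟨ solve 4 (λ α β b B → (α :* b :+ β) :* B := α :* (b :* B) :+ β :* B)
                   refl α β b (b ^′ n) ⟩
      α * (b * b ^′ n) + β * b ^′ n
        ∎

  module Generating (y : Carrier) where

    term : ℕ → ℕ → Carrier
    term j k = ι (pRec j k) * y ^′ k

    P : ℕ → Carrier
    P j = sumTo j (term j)

    term-vanish : ∀ j k → j < k → term j k ≈ 0#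
    term-vanish j k j<k = trans (*-cong (reflexive (≡.cong ι (pRec-vanish j k j<k))) refl) (zeroˡ _)

    -- g n y is P n: p_{n,k} = pRec n k, and the terms with k > n vanish.
    g≈P : ∀ n → g n y ≈ P n
    g≈P n = begin
      g n y
        ≈⟨ sumTo-cong (suc (2 *ℕ n)) (λ k → *-cong (reflexive (≡.cong ι (p≡pRec n k))) refl) ⟩
      sumTo (suc (2 *ℕ n)) (term n)
        ≈⟨ sumTo-extend (term n) (term-vanish n) (≤-trans (m≤m+n n _) (n≤1+n _)) ⟩
      P n
        ∎

    P-rec : ∀ j → P (suc (suc j)) ≈ P (suc j) + ι 2 * (y * P j)
    P-rec j = begin
      sumTo (suc (suc j)) (term (suc (suc j)))
        ≈⟨ sumTo-cong (suc (suc j)) split ⟩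
      sumTo (suc (suc j)) (λ k → term (suc j) k + lower k)
        ≈⟨ sumTo-+ (suc (suc j)) (term (suc j)) lower ⟩
      sumTo (suc (suc j)) (term (suc j)) + sumTo (suc (suc j)) lower
        ≈⟨ +-cong (sumTo-extend (term (suc j)) (term-vanish (suc j)) (n≤1+n _))
                  (sumTo-shift (suc j) lower) ⟩
      P (suc j) + (lower 0 + sumTo (suc j) (lower ∘ suc))
        ≈⟨ +-cong refl (+-cong (zeroˡ 1#) (sumTo-cong (suc j) lower-suc)) ⟩
      P (suc j) + (0# + sumTo (suc j) (λ k → ι 2 * (y * term j k)))
        ≈⟨ +-cong refl (trans (+-identityˡ _) (sumTo-*ˡ (suc j) (ι 2) (λ k → y * term j k))) ⟩
      P (suc j) + ι 2 * sumTo (suc j) (λ k → y * term j k)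
        ≈⟨ +-cong refl (*-cong refl (sumTo-*ˡ (suc j) y (term j))) ⟩
      P (suc j) + ι 2 * (y * sumTo (suc j) (term j))
        ≈⟨ +-cong refl (*-cong refl (*-cong refl (sumTo-extend (term j) (term-vanish j) (n≤1+n j)))) ⟩
      P (suc j) + ι 2 * (y * P j)
        ∎
      where
      -- the part of term (j+2) k coming from 2y · P j
      lower : ℕ → Carrier
      lower k = ι (2 *ℕ timesY (pRec j) k) * y ^′ k
      split : ∀ k → term (suc (suc j)) k ≈ term (suc j) k + lower k
      split k = trans (*-cong ι-split refl) (distribʳ (y ^′ k) _ _)
        where
        ι-split : ι (pRec (suc (suc j)) k) ≈ ι (pRec (suc j) k) + ι (2 *ℕ timesY (pRec j) k)
        ι-split = trans (reflexive (≡.cong ι (pRec-suc (suc j) k)))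
                        (ι-+ (pRec (suc j) k) (2 *ℕ timesY (pRec j) k))
      lower-suc : ∀ k → lower (suc k) ≈ ι 2 * (y * term j k)
      lower-suc k = trans (*-cong (ι-* 2 (pRec j k)) refl)
        (solve 3 (λ a y Y → (ι̂ 2 :* a) :* (y :* Y) := ι̂ 2 :* (y :* (a :* Y)))
                 refl (ι (pRec j k)) y (y ^′ k))

  move : ∀ a b c d e → a + (b + d) ≈ c + e → a ≈ c - b + e - d
  move a b c d e h = sym (begin
      c + - b + e + - d
        ≈⟨ solve 4 (λ c nb e nd → c :+ nb :+ e :+ nd := (c :+ e) :+ (nb :+ nd))
                   refl c (- b) e (- d) ⟩
      (c + e) + (- b + - d)
        ≈⟨ +-cong (sym h) refl ⟩
      (a + (b + d)) + (- b + - d)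
        ≈⟨ solve 5 (λ a b d nb nd → (a :+ (b :+ d)) :+ (nb :+ nd) := a :+ ((b :+ nb) :+ (d :+ nd)))
                   refl a b d (- b) (- d) ⟩
      a + ((b + - b) + (d + - d))
        ≈⟨ +-cong refl (trans (+-cong (-‿inverseʳ b) (-‿inverseʳ d)) (+-identityʳ 0#)) ⟩
      a + 0#
        ≈⟨ +-identityʳ a ⟩
      a ∎)

  module Solution (y s : Carrier) (s²≈ : s * s ≈ 1# + ι 8 * y) where
    open Generating y

    root : ∀ z → z * z ≈ 1# + ι 8 * y → (1# + z) * (1# + z) ≈ ι 2 * (1# + z) + ι 8 * y
    root z z²≈ = begin
      (1# + z) * (1# + z)
        ≈⟨ solve 1 (λ z → (con 1 :+ z) :* (con 1 :+ z) := ι̂ 2 :* z :+ (con 1 :+ z :* z)) refl z ⟩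
      ι 2 * z + (1# + z * z)
        ≈⟨ +-cong refl (+-cong refl z²≈) ⟩
      ι 2 * z + (1# + (1# + ι 8 * y))
        ≈⟨ solve 2 (λ z e → ι̂ 2 :* z :+ (con 1 :+ (con 1 :+ e)) := ι̂ 2 :* (con 1 :+ z) :+ e)
                   refl z (ι 8 * y) ⟩
      ι 2 * (1# + z) + ι 8 * y
        ∎

    discard : ∀ a q → a + q * (s + - s) ≈ a
    discard a q = trans (+-cong refl (trans (*-cong refl (-‿inverseʳ s)) (zeroʳ q))) (+-identityʳ a)

    -s²≈ : - s * - s ≈ 1# + ι 8 * y
    -s²≈ = begin
      - s * - s
        ≈⟨ discard (- s * - s) s ⟨
      - s * - s + s * (s + - s)
        ≈⟨ solve 2 (λ s w → w :* w :+ s :* (s :+ w) := s :* s :+ w :* (s :+ w)) refl s (- s) ⟩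
      s * s + - s * (s + - s)
        ≈⟨ discard (s * s) (- s) ⟩
      s * s
        ≈⟨ s²≈ ⟩
      1# + ι 8 * y
        ∎

    X Y Z : ℕ → Carrier
    X n = (1# + s) ^′ n
    Y n = (1# - s) ^′ n
    Z n = ι 2 ^′ suc n * s * P n

    X-rec : Rec (ι 2) (ι 8 * y) X
    X-rec = rec-pow (1# + s) (root s s²≈)

    Y-rec : Rec (ι 2) (ι 8 * y) Y
    Y-rec = rec-pow (1# - s) (root (- s) -s²≈)

    -- For Z this is the recurrence P (n+2) = P (n+1) + 2y P n, multiplied by 2^{n+3} s.
    Z-rec : Rec (ι 2) (ι 8 * y) Z
    Z-rec n = begin
      ι 2 * (ι 2 * Q) * s * P (suc (suc n))
        ≈⟨ *-cong refl (P-rec n) ⟩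
      ι 2 * (ι 2 * Q) * s * (P (suc n) + ι 2 * (y * P n))
        ≈⟨ solve 5 (λ Q s A B y → ι̂ 2 :* (ι̂ 2 :* Q) :* s :* (A :+ ι̂ 2 :* (y :* B))
                   := ι̂ 2 :* (ι̂ 2 :* Q :* s :* A) :+ ι̂ 8 :* y :* (Q :* s :* B))
                   refl Q s (P (suc n)) (P n) y ⟩
      ι 2 * (ι 2 * Q * s * P (suc n)) + ι 8 * y * (Q * s * P n)
        ∎
      where
      Q : Carrier
      Q = ι 2 ^′ suc n

    lhs rhs : ℕ → Carrier
    lhs n = Z n + (ι 4 * y * Y n + Y (suc n))
    rhs n = ι 4 * y * X n + X (suc n)

    lhs-rec : Rec (ι 2) (ι 8 * y) lhs
    lhs-rec = rec-+ Z-rec (rec-+ (rec-scale (ι 4 * y) Y-rec) (rec-shift Y-rec))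

    rhs-rec : Rec (ι 2) (ι 8 * y) rhs
    rhs-rec = rec-+ (rec-scale (ι 4 * y) X-rec) (rec-shift X-rec)

    base₀ : lhs 0 ≈ rhs 0
    base₀ = begin
      lhs 0
        ≈⟨ solve 3 (λ s w y →
             (ι̂ 2 :* con 1) :* s :* (ι̂ 1 :* con 1) :+ (ι̂ 4 :* y :* con 1 :+ (con 1 :+ w) :* con 1)
             := (ι̂ 4 :* y :* con 1 :+ (con 1 :+ s) :* con 1) :+ con 1 :* (s :+ w)) refl s (- s) y ⟩
      rhs 0 + 1# * (s + - s)
        ≈⟨ discard (rhs 0) 1# ⟩
      rhs 0 ∎

    base₁ : lhs 1 ≈ rhs 1
    base₁ = begin
      lhs 1
        ≈⟨ +-cong refl (+-cong refl (Y-rec 0)) ⟩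
      Z 1 + (ι 4 * y * Y 1 + (ι 2 * Y 1 + ι 8 * y * Y 0))
        ≈⟨ solve 3 (λ s w y →
             ι̂ 2 :* (ι̂ 2 :* con 1) :* s :* (ι̂ 1 :* con 1 :+ ι̂ 2 :* (y :* con 1))
               :+ (ι̂ 4 :* y :* ((con 1 :+ w) :* con 1)
                   :+ (ι̂ 2 :* ((con 1 :+ w) :* con 1) :+ ι̂ 8 :* y :* con 1))
             := (ι̂ 4 :* y :* ((con 1 :+ s) :* con 1)
                   :+ (ι̂ 2 :* ((con 1 :+ s) :* con 1) :+ ι̂ 8 :* y :* con 1))
               :+ (ι̂ 2 :+ ι̂ 4 :* y) :* (s :+ w)) refl s (- s) y ⟩
      (ι 4 * y * X 1 + (ι 2 * X 1 + ι 8 * y * X 0)) + (ι 2 + ι 4 * y) * (s + - s)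
        ≈⟨ discard _ _ ⟩
      ι 4 * y * X 1 + (ι 2 * X 1 + ι 8 * y * X 0)
        ≈⟨ +-cong refl (X-rec 0) ⟨
      rhs 1 ∎

    -- Hence they agree everywhere, which rearranges to the closed form of Z.
    Z-closed : ∀ n → Z n ≈ ι 4 * y * X n - ι 4 * y * Y n + X (suc n) - Y (suc n)
    Z-closed n = move _ _ _ _ _ (rec-unique lhs-rec rhs-rec base₀ base₁ n)

lemmaB1 : ∀ {c ℓ} (R : CommutativeRing c ℓ) →
    let open CommutativeRing R
        open RingOps R
    in (y s : Carrier) → s * s ≈ 1# + ι 8 * y → (n : ℕ) →
       ι 2 ^′ suc n * s * g n y
         ≈ ι 4 * y * (1# + s) ^′ n - ι 4 * y * (1# - s) ^′ n
           + (1# + s) ^′ suc n - (1# - s) ^′ suc n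
lemmaB1 R y s s²≈ n = begin
    ι 2 ^′ suc n * s * g n y  ≈⟨ *-cong refl (g≈P n) ⟩
    Z n                       ≈⟨ Z-closed n ⟩
    ι 4 * y * X n - ι 4 * y * Y n + X (suc n) - Y (suc n) ∎
  where
  open CommutativeRing R
  open RingOps R
  open ClosedForm R using (module Generating; module Solution)
  open Generating y using (g≈P)
  open Solution y s s²≈ using (X; Y; Z; Z-closed)
  open import Relation.Binary.Reasoning.Setoid setoid
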